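{- Consider the classical secretary problem in the comparison model where the number of candidates $n$ is chosen by an adversary from $\{1,\dots,N\}$, $N$ is known in advance, the candidates' relative ranking is uniformly random, the algorithm observes only relative ranks of candidates seen so far, and it must irrevocably select at most one candidate. Then the best possible probability $\alpha$ (guaranteed simultaneously for all $n\in\{1,\dots,N\}$) with which an algorithm selects the best among the first $n$ candidates equals the optimum value of the linear program $$\max\ \alpha\quad\text{s.t.}\quad \frac1n\sum_{i=1}^n i\,p_i\ge\alpha\ \ \forall n\le N;\qquad \sum_{j=1}^{i-1}p_j+i\,p_i\le 1\ \ \forall i\le N;\qquad p_i\ge 0\ \ \forall i\le N.$$
   Formalization: The algorithms' probabilities of selecting a candidate, the value $\alpha$ and the LP variables $p_i$ are all rational. -}

module Defs where

open import Data.Nat as ℕ using (ℕ; zero; suc; _!)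
open import Data.Nat.Properties using (_!≢0)
open import Data.Fin using (Fin; zero; suc)
open import Data.Fin.Properties using (_≟_)
open import Data.List using (List; []; _∷_; concatMap; map)
open import Data.List.Base using (allFin)
open import Data.Integer using (+_)
open import Data.Rational using (ℚ; 0ℚ; 1ℚ; _+_; _*_; _-_; _≤_; _/_)
open import Data.Product using (Σ; _×_; _,_; proj₁; proj₂; ∃)
open import Relation.Nullary using (yes; no)

-- A value of type  RR i  is the sequence (r₁,…,rᵢ) of relative ranks
-- of the first i candidates, where rₖ : Fin k is the rank of candidate k
-- among candidates 1..k (zero = best so far).  These sequences are in
-- bijection with the relative orderings of the first i candidates, and a
-- uniformly random ordering corresponds to the uniform distribution on
-- RR i.

data RR : ℕ → Set where
  ∅   : RR zero
  _▷_ : ∀ {i} → RR i → Fin (suc i) → RR (suc i)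

allRR : (n : ℕ) → List (RR n)
allRR zero    = ∅ ∷ []
allRR (suc n) = concatMap (λ h → map (h ▷_) (allFin (suc n))) (allRR n)

-- After seeing candidate i (i.e. the history r₁..rᵢ, and not having
-- stopped before), the algorithm selects candidate i with probability
-- stop h ∈ [0,1].  (Behavioural form of an arbitrary randomized
-- algorithm; it only sees relative ranks, and never sees n.)

record Algorithm : Set where
  field
    stop    : ∀ {i} → RR (suc i) → ℚ
    stop≥0  : ∀ {i} (h : RR (suc i)) → 0ℚ ≤ stop h
    stop≤1  : ∀ {i} (h : RR (suc i)) → stop h ≤ 1ℚ

open Algorithm public

-- For a history h of length i:
--   proj₁ = probability that the algorithm has not selected anyone yet,
--   proj₂ = probability that it has selected someone who is the best
--           among the first i candidates.
run : Algorithm → ∀ {i} → RR i → ℚ × ℚ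
run A ∅ = 1ℚ , 0ℚ
run A (h ▷ r) with run A h
... | c , s with r ≟ zero
...   | yes _ = c * (1ℚ - stop A (h ▷ r)) , c * stop A (h ▷ r)
...   | no  _ = c * (1ℚ - stop A (h ▷ r)) , s

sumℚ : List ℚ → ℚ
sumℚ []       = 0ℚ
sumℚ (x ∷ xs) = x + sumℚ xs

successProb : Algorithm → ℕ → ℚ
successProb A n =
  sumℚ (map (λ h → proj₂ (run A h)) (allRR n)) * ((+ 1) / (n !)) {{n !≢0}}

Achievable : ℕ → ℚ → Set
Achievable N α = ∃ λ (A : Algorithm) → ∀ n → 1 ℕ.≤ n → n ℕ.≤ N → α ≤ successProb A n

Σ₁ : ℕ → (ℕ → ℚ) → ℚ
Σ₁ zero    f = 0ℚ
Σ₁ (suc n) f = Σ₁ n f + f (suc n)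

ℕ→ℚ : ℕ → ℚ
ℕ→ℚ k = (+ k) / 1

LPFeasible : ℕ → ℚ → (ℕ → ℚ) → Set
LPFeasible N α p =
    (∀ n → (1≤n : 1 ℕ.≤ n) → n ℕ.≤ N →
       α ≤ ((+ 1) / n) {{ℕ.>-nonZero 1≤n}} * Σ₁ n (λ i → ℕ→ℚ i * p i))
  × (∀ i → 1 ℕ.≤ i → i ℕ.≤ N → Σ₁ (i ℕ.∸ 1) p + ℕ→ℚ i * p i ≤ 1ℚ)
  × (∀ i → 1 ℕ.≤ i → i ℕ.≤ N → 0ℚ ≤ p i)

module Submission where

-- Let s_n be the probability that the algorithm has not stopped after n candidates and x_i the
-- probability that it stops at candidate i while i is the best so far. Because the relative rank of
-- candidate n+1 is uniform and independent of the past, (n+1) x_{n+1} ≤ s_n, s_{n+1} + x_{n+1} ≤ s_n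
-- with s_0 = 1, and the success probability t_n obeys (n+1) t_{n+1} = n t_n + (n+1) x_{n+1}; hence
-- t_n = (1/n) Σ_{i≤n} i x_i and p = x is feasible for the LP. Conversely, a feasible p is realised by
-- stopping at a best-so-far candidate i+1 with probability (i+1) p_{i+1} / (1 − Σ_{j≤i} p_j) and at no
-- other candidate: then the inequalities become equalities, s_n = 1 − Σ_{j≤n} p_j and x = p.

open import Defs
open import Data.Nat as ℕ using (ℕ; zero; suc; _!; _≤_; s≤s; z≤n)
open import Data.Nat.Properties as ℕ using (_!≢0)
open import Data.Fin as Fin using (Fin; zero; suc)
open import Data.List using (List; []; _∷_; _++_; map; concatMap; tabulate; allFin)
open import Data.Integer as ℤ using (1ℤ)
open import Data.Integer.Tactic.RingSolver using (solve-∀)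
open import Data.Rational as ℚ hiding (_≤_)
open import Data.Rational.Properties
import Data.Rational.Unnormalised as ℚᵘ
import Data.Rational.Unnormalised.Properties as ℚᵘ
open import Data.Rational.Solver using (module +-*-Solver)
open +-*-Solver using (solve; _:+_; _:*_; _:-_; _:=_; con)
open import Data.Product using (_×_; _,_; proj₁; proj₂; ∃)
open import Data.Empty using (⊥-elim)
open import Relation.Nullary using (yes; no)
open import Function.Bundles using (_⇔_; mk⇔)
open import Relation.Binary.PropositionalEquality

toℚᵘ-ℕ→ℚ : ∀ k → toℚᵘ (ℕ→ℚ k) ℚᵘ.≃ ℚᵘ.mkℚᵘ (ℤ.+ k) 0
toℚᵘ-ℕ→ℚ k = toℚᵘ-fromℚᵘ (ℚᵘ.mkℚᵘ (ℤ.+ k) 0)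

ℕ→ℚ-+ : ∀ m n → ℕ→ℚ (m ℕ.+ n) ≡ ℕ→ℚ m + ℕ→ℚ n
ℕ→ℚ-+ m n = toℚᵘ-injective (begin-equality
  toℚᵘ (ℕ→ℚ (m ℕ.+ n))                      ≃⟨ toℚᵘ-ℕ→ℚ (m ℕ.+ n) ⟩
  ℚᵘ.mkℚᵘ (ℤ.+ m ℤ.+ ℤ.+ n) 0                ≃⟨ ℚᵘ.*≡* (cross-multiplied (ℤ.+ m) (ℤ.+ n)) ⟩
  ℚᵘ.mkℚᵘ (ℤ.+ m) 0 ℚᵘ.+ ℚᵘ.mkℚᵘ (ℤ.+ n) 0    ≃⟨ ℚᵘ.+-cong (toℚᵘ-ℕ→ℚ m) (toℚᵘ-ℕ→ℚ n) ⟨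
  toℚᵘ (ℕ→ℚ m) ℚᵘ.+ toℚᵘ (ℕ→ℚ n)             ≃⟨ toℚᵘ-homo-+ (ℕ→ℚ m) (ℕ→ℚ n) ⟨
  toℚᵘ (ℕ→ℚ m + ℕ→ℚ n)                       ∎)
  where
  open ℚᵘ.≤-Reasoning
  cross-multiplied : ∀ a b → (a ℤ.+ b) ℤ.* (1ℤ ℤ.* 1ℤ) ≡ (a ℤ.* 1ℤ ℤ.+ b ℤ.* 1ℤ) ℤ.* 1ℤ
  cross-multiplied = solve-∀

ℕ→ℚ-suc : ∀ n → ℕ→ℚ (suc n) ≡ 1ℚ + ℕ→ℚ n
ℕ→ℚ-suc = ℕ→ℚ-+ 1

ℕ→ℚ-* : ∀ m n → ℕ→ℚ (m ℕ.* n) ≡ ℕ→ℚ m * ℕ→ℚ n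
ℕ→ℚ-* zero    n = sym (*-zeroˡ (ℕ→ℚ n))
ℕ→ℚ-* (suc m) n = begin
  ℕ→ℚ (n ℕ.+ m ℕ.* n)        ≡⟨ ℕ→ℚ-+ n (m ℕ.* n) ⟩
  ℕ→ℚ n + ℕ→ℚ (m ℕ.* n)      ≡⟨ cong (λ q → ℕ→ℚ n + q) (ℕ→ℚ-* m n) ⟩
  ℕ→ℚ n + ℕ→ℚ m * ℕ→ℚ n      ≡⟨ solve 2 (λ m n → n :+ m :* n := (con 1ℚ :+ m) :* n) refl (ℕ→ℚ m) (ℕ→ℚ n) ⟩
  (1ℚ + ℕ→ℚ m) * ℕ→ℚ n       ≡⟨ cong (_* ℕ→ℚ n) (ℕ→ℚ-suc m) ⟨
  ℕ→ℚ (suc m) * ℕ→ℚ n        ∎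
  where open ≡-Reasoning

0≤ℕ→ℚ : ∀ n → 0ℚ ℚ.≤ ℕ→ℚ n
0≤ℕ→ℚ n = nonNegative⁻¹ (ℕ→ℚ n) {{normalize-nonNeg n 1}}

1/n*n≡1 : ∀ n .{{_ : ℕ.NonZero n}} → (1ℤ / n) * ℕ→ℚ n ≡ 1ℚ
1/n*n≡1 (suc n) = toℚᵘ-injective (begin-equality
  toℚᵘ (1ℤ / suc n * ℕ→ℚ (suc n))               ≃⟨ toℚᵘ-homo-* (1ℤ / suc n) (ℕ→ℚ (suc n)) ⟩
  toℚᵘ (1ℤ / suc n) ℚᵘ.* toℚᵘ (ℕ→ℚ (suc n))
    ≃⟨ ℚᵘ.*-cong (toℚᵘ-fromℚᵘ (ℚᵘ.mkℚᵘ 1ℤ n)) (toℚᵘ-ℕ→ℚ (suc n)) ⟩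
  ℚᵘ.mkℚᵘ 1ℤ n ℚᵘ.* ℚᵘ.mkℚᵘ (ℤ.+ suc n) 0       ≃⟨ ℚᵘ.*≡* (cross-multiplied (ℤ.+ suc n)) ⟩
  ℚᵘ.1ℚᵘ                                        ∎)
  where
  open ℚᵘ.≤-Reasoning
  cross-multiplied : ∀ a → (1ℤ ℤ.* a) ℤ.* 1ℤ ≡ 1ℤ ℤ.* (a ℤ.* 1ℤ)
  cross-multiplied = solve-∀

1/n*[n*p]≡p : ∀ n .{{_ : ℕ.NonZero n}} p → (1ℤ / n) * (ℕ→ℚ n * p) ≡ p
1/n*[n*p]≡p n p = begin
  (1ℤ / n) * (ℕ→ℚ n * p)  ≡⟨ *-assoc (1ℤ / n) (ℕ→ℚ n) p ⟨
  (1ℤ / n) * ℕ→ℚ n * p    ≡⟨ cong (_* p) (1/n*n≡1 n) ⟩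
  1ℚ * p                  ≡⟨ *-identityˡ p ⟩
  p                       ∎
  where open ≡-Reasoning

ℕ→ℚ-*-cancelˡ : ∀ n {p q} → ℕ→ℚ (suc n) * p ≡ ℕ→ℚ (suc n) * q → p ≡ q
ℕ→ℚ-*-cancelˡ n {p} {q} eq = begin
  p                                 ≡⟨ 1/n*[n*p]≡p (suc n) p ⟨
  (1ℤ / suc n) * (ℕ→ℚ (suc n) * p)  ≡⟨ cong ((1ℤ / suc n) *_) eq ⟩
  (1ℤ / suc n) * (ℕ→ℚ (suc n) * q)  ≡⟨ 1/n*[n*p]≡p (suc n) q ⟩
  q                                 ∎
  where open ≡-Reasoning

invFactorial : ℕ → ℚ
invFactorial n = (1ℤ / (n !)) {{n !≢0}}

invFactorial-suc : ∀ n → invFactorial n ≡ ℕ→ℚ (suc n) * invFactorial (suc n)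
invFactorial-suc n = begin
  w n                                       ≡⟨ *-identityʳ (w n) ⟨
  w n * 1ℚ                                  ≡⟨ cong (w n *_) (1/n*n≡1 (suc n !) {{suc n !≢0}}) ⟨
  w n * (w (suc n) * ℕ→ℚ (suc n ℕ.* n !))   ≡⟨ cong (λ q → w n * (w (suc n) * q)) (ℕ→ℚ-* (suc n) (n !)) ⟩
  w n * (w (suc n) * (ℕ→ℚ (suc n) * ℕ→ℚ (n !)))
    ≡⟨ solve 4 (λ u v m k → u :* (v :* (m :* k)) := (u :* k) :* (m :* v)) refl (w n) (w (suc n)) (ℕ→ℚ (suc n)) (ℕ→ℚ (n !)) ⟩
  (w n * ℕ→ℚ (n !)) * (ℕ→ℚ (suc n) * w (suc n)) ≡⟨ cong (_* (ℕ→ℚ (suc n) * w (suc n))) (1/n*n≡1 (n !) {{n !≢0}}) ⟩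
  1ℚ * (ℕ→ℚ (suc n) * w (suc n))            ≡⟨ *-identityˡ _ ⟩
  ℕ→ℚ (suc n) * w (suc n)                   ∎
  where
  open ≡-Reasoning
  w = invFactorial

0≤invFactorial : ∀ n → 0ℚ ℚ.≤ invFactorial n
0≤invFactorial n = nonNegative⁻¹ (invFactorial n) {{normalize-nonNeg 1 (n !) {{n !≢0}}}}

0≤p*q : ∀ {p q} → 0ℚ ℚ.≤ p → 0ℚ ℚ.≤ q → 0ℚ ℚ.≤ p * q
0≤p*q {p} {q} 0≤p 0≤q =
  nonNegative⁻¹ (p * q) {{nonNeg*nonNeg⇒nonNeg p {{nonNegative 0≤p}} q {{nonNegative 0≤q}}}}

0≤1-p : ∀ {p} → p ℚ.≤ 1ℚ → 0ℚ ℚ.≤ 1ℚ - p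
0≤1-p {p} p≤1 = begin
  0ℚ      ≡⟨ +-inverseʳ p ⟨
  p - p   ≤⟨ +-monoˡ-≤ (- p) p≤1 ⟩
  1ℚ - p  ∎
  where open ≤-Reasoning

p*q≤p : ∀ {p q} → 0ℚ ℚ.≤ p → q ℚ.≤ 1ℚ → p * q ℚ.≤ p
p*q≤p {p} {q} 0≤p q≤1 = begin
  p * q   ≤⟨ *-monoˡ-≤-nonNeg p {{nonNegative 0≤p}} q≤1 ⟩
  p * 1ℚ  ≡⟨ *-identityʳ p ⟩
  p       ∎
  where open ≤-Reasoning

ratio∈[0,1] : ∀ {a d} → 0ℚ ℚ.≤ a → a ℚ.≤ d → ∃ λ q → (0ℚ ℚ.≤ q × q ℚ.≤ 1ℚ) × d * q ≡ a
ratio∈[0,1] {a} {d} 0≤a a≤d with 0ℚ <? d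
... | yes 0<d = a * 1/ d , (0≤p*q 0≤a 0≤1/d , a/d≤1) , d*[a/d]≡a
  where
  instance
    d>0 : Positive d
    d>0 = positive 0<d
    d≢0 : NonZero d
    d≢0 = pos⇒nonZero d
  0≤1/d : 0ℚ ℚ.≤ 1/ d
  0≤1/d = nonNegative⁻¹ _ {{pos⇒nonNeg (1/ d) {{1/pos⇒pos d}}}}
  a/d≤1 : a * 1/ d ℚ.≤ 1ℚ
  a/d≤1 = ≤-trans (*-monoʳ-≤-nonNeg (1/ d) {{nonNegative 0≤1/d}} a≤d) (≤-reflexive (*-inverseʳ d))
  d*[a/d]≡a : d * (a * 1/ d) ≡ a
  d*[a/d]≡a = begin
    d * (a * 1/ d) ≡⟨ solve 3 (λ d a e → d :* (a :* e) := a :* (d :* e)) refl d a (1/ d) ⟩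
    a * (d * 1/ d) ≡⟨ cong (a *_) (*-inverseʳ d) ⟩
    a * 1ℚ         ≡⟨ *-identityʳ a ⟩
    a              ∎
    where open ≡-Reasoning
... | no  0≮d = 0ℚ , (≤-refl , ≤ᵇ⇒≤ _) , trans (*-zeroʳ d) (≤-antisym 0≤a (≤-trans a≤d (≮⇒≥ 0≮d)))

module _ {A : Set} where

  ΣL : List A → (A → ℚ) → ℚ
  ΣL xs f = sumℚ (map f xs)

  ΣL-cong : ∀ xs {f g} → (∀ x → f x ≡ g x) → ΣL xs f ≡ ΣL xs g
  ΣL-cong []       f≡g = refl
  ΣL-cong (x ∷ xs) f≡g = cong₂ _+_ (f≡g x) (ΣL-cong xs f≡g)

  ΣL-mono-≤ : ∀ xs {f g} → (∀ x → f x ℚ.≤ g x) → ΣL xs f ℚ.≤ ΣL xs g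
  ΣL-mono-≤ []       f≤g = ≤-refl
  ΣL-mono-≤ (x ∷ xs) f≤g = +-mono-≤ (f≤g x) (ΣL-mono-≤ xs f≤g)

  0≤ΣL : ∀ xs {f} → (∀ x → 0ℚ ℚ.≤ f x) → 0ℚ ℚ.≤ ΣL xs f
  0≤ΣL []       0≤f = ≤-refl
  0≤ΣL (x ∷ xs) 0≤f = +-mono-≤ (0≤f x) (0≤ΣL xs 0≤f)

  ΣL-+ : ∀ xs f g → ΣL xs (λ x → f x + g x) ≡ ΣL xs f + ΣL xs g
  ΣL-+ []       f g = refl
  ΣL-+ (x ∷ xs) f g = trans (cong ((f x + g x) +_) (ΣL-+ xs f g))
    (solve 4 (λ a b c d → a :+ b :+ (c :+ d) := a :+ c :+ (b :+ d)) refl (f x) (g x) (ΣL xs f) (ΣL xs g))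

  ΣL-*ˡ : ∀ xs c f → ΣL xs (λ x → c * f x) ≡ c * ΣL xs f
  ΣL-*ˡ []       c f = sym (*-zeroʳ c)
  ΣL-*ˡ (x ∷ xs) c f = trans (cong (c * f x +_) (ΣL-*ˡ xs c f)) (sym (*-distribˡ-+ c (f x) (ΣL xs f)))

  ΣL-++ : ∀ xs ys f → ΣL (xs ++ ys) f ≡ ΣL xs f + ΣL ys f
  ΣL-++ []       ys f = sym (+-identityˡ (ΣL ys f))
  ΣL-++ (x ∷ xs) ys f = trans (cong (f x +_) (ΣL-++ xs ys f)) (sym (+-assoc (f x) (ΣL xs f) (ΣL ys f)))

  ΣL-tabulate-const : ∀ {n} (g : Fin n → A) f v → (∀ i → f (g i) ≡ v) → ΣL (tabulate g) f ≡ ℕ→ℚ n * v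
  ΣL-tabulate-const {zero}  g f v fg≡v = sym (*-zeroˡ v)
  ΣL-tabulate-const {suc n} g f v fg≡v = begin
    f (g zero) + ΣL (tabulate (λ i → g (suc i))) f
      ≡⟨ cong₂ _+_ (fg≡v zero) (ΣL-tabulate-const (λ i → g (suc i)) f v (λ i → fg≡v (suc i))) ⟩
    v + ℕ→ℚ n * v                                   ≡⟨ solve 2 (λ v n → v :+ n :* v := (con 1ℚ :+ n) :* v) refl v (ℕ→ℚ n) ⟩
    (1ℚ + ℕ→ℚ n) * v                                ≡⟨ cong (_* v) (ℕ→ℚ-suc n) ⟨
    ℕ→ℚ (suc n) * v                                 ∎
    where open ≡-Reasoning

ΣL-concatMap : ∀ {A B : Set} (xs : List A) (g : A → List B) f → ΣL (concatMap g xs) f ≡ ΣL xs (λ x → ΣL (g x) f)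
ΣL-concatMap []       g f = refl
ΣL-concatMap (x ∷ xs) g f = trans (ΣL-++ (g x) (concatMap g xs) f) (cong (ΣL (g x) f +_) (ΣL-concatMap xs g f))

ΣL-map : ∀ {A B : Set} (xs : List A) (g : A → B) f → ΣL (map g xs) f ≡ ΣL xs (λ x → f (g x))
ΣL-map []       g f = refl
ΣL-map (x ∷ xs) g f = cong (f (g x) +_) (ΣL-map xs g f)

𝔼 : (n : ℕ) → (RR n → ℚ) → ℚ
𝔼 n f = ΣL (allRR n) f * invFactorial n

Σ▷ : ∀ {n} → (RR (suc n) → ℚ) → RR n → ℚ
Σ▷ {n} f h = ΣL (allFin (suc n)) (λ r → f (h ▷ r))

module _ (n : ℕ) where

  𝔼-cong : ∀ {f g} → (∀ h → f h ≡ g h) → 𝔼 n f ≡ 𝔼 n g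
  𝔼-cong f≡g = cong (_* invFactorial n) (ΣL-cong (allRR n) f≡g)

  𝔼-mono-≤ : ∀ {f g} → (∀ h → f h ℚ.≤ g h) → 𝔼 n f ℚ.≤ 𝔼 n g
  𝔼-mono-≤ f≤g = *-monoʳ-≤-nonNeg (invFactorial n) {{nonNegative (0≤invFactorial n)}} (ΣL-mono-≤ (allRR n) f≤g)

  0≤𝔼 : ∀ {f} → (∀ h → 0ℚ ℚ.≤ f h) → 0ℚ ℚ.≤ 𝔼 n f
  0≤𝔼 0≤f = 0≤p*q (0≤ΣL (allRR n) 0≤f) (0≤invFactorial n)

  𝔼-+ : ∀ f g → 𝔼 n (λ h → f h + g h) ≡ 𝔼 n f + 𝔼 n g
  𝔼-+ f g = trans (cong (_* invFactorial n) (ΣL-+ (allRR n) f g))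
                  (*-distribʳ-+ (invFactorial n) (ΣL (allRR n) f) (ΣL (allRR n) g))

  𝔼-*ˡ : ∀ c f → 𝔼 n (λ h → c * f h) ≡ c * 𝔼 n f
  𝔼-*ˡ c f = trans (cong (_* invFactorial n) (ΣL-*ˡ (allRR n) c f))
                   (*-assoc c (ΣL (allRR n) f) (invFactorial n))

  -- The relative rank of candidate n+1 is uniform on Fin (suc n), independently of the history.
  𝔼-suc : ∀ f → ℕ→ℚ (suc n) * 𝔼 (suc n) f ≡ 𝔼 n (Σ▷ f)
  𝔼-suc f = begin
    ℕ→ℚ (suc n) * (ΣL (allRR (suc n)) f * w (suc n))
      ≡⟨ solve 3 (λ m s v → m :* (s :* v) := s :* (m :* v)) refl (ℕ→ℚ (suc n)) (ΣL (allRR (suc n)) f) (w (suc n)) ⟩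
    ΣL (allRR (suc n)) f * (ℕ→ℚ (suc n) * w (suc n))
      ≡⟨ cong₂ _*_ (ΣL-concatMap (allRR n) (λ h → map (h ▷_) (allFin (suc n))) f) (sym (invFactorial-suc n)) ⟩
    ΣL (allRR n) (λ h → ΣL (map (h ▷_) (allFin (suc n))) f) * w n
      ≡⟨ cong (_* w n) (ΣL-cong (allRR n) (λ h → ΣL-map (allFin (suc n)) (h ▷_) f)) ⟩
    𝔼 n (Σ▷ f) ∎
    where
    open ≡-Reasoning
    w = invFactorial

module Run (A : Algorithm) where

  unstopped won : ∀ {i} → RR i → ℚ
  unstopped h = proj₁ (run A h)
  won       h = proj₂ (run A h)

  stopMass bestStopMass : ∀ {i} → RR (suc i) → ℚ
  stopMass (h ▷ r) = unstopped h * stop A (h ▷ r)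
  bestStopMass (h ▷ zero)  = stopMass (h ▷ zero)
  bestStopMass (h ▷ suc r) = 0ℚ

  unstopped-▷ : ∀ {i} (h : RR i) r → unstopped (h ▷ r) ≡ unstopped h * (1ℚ - stop A (h ▷ r))
  unstopped-▷ h zero    = refl
  unstopped-▷ h (suc r) = refl

  0≤unstopped : ∀ {i} (h : RR i) → 0ℚ ℚ.≤ unstopped h
  0≤unstopped ∅       = ≤ᵇ⇒≤ _
  0≤unstopped (h ▷ r) = subst (0ℚ ℚ.≤_) (sym (unstopped-▷ h r)) (0≤p*q (0≤unstopped h) (0≤1-p (stop≤1 A (h ▷ r))))

  0≤stopMass : ∀ {i} (h : RR (suc i)) → 0ℚ ℚ.≤ stopMass h
  0≤stopMass (h ▷ r) = 0≤p*q (0≤unstopped h) (stop≥0 A (h ▷ r))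

  bestStopMass≤stopMass : ∀ {i} (h : RR (suc i)) → bestStopMass h ℚ.≤ stopMass h
  bestStopMass≤stopMass (h ▷ zero)  = ≤-refl
  bestStopMass≤stopMass (h ▷ suc r) = 0≤stopMass (h ▷ suc r)

  unstopped-conservation : ∀ {i} (h : RR i) r → unstopped (h ▷ r) + stopMass (h ▷ r) ≡ unstopped h
  unstopped-conservation h r = trans (cong (_+ stopMass (h ▷ r)) (unstopped-▷ h r))
    (solve 2 (λ c s → c :* (con 1ℚ :- s) :+ c :* s := c) refl (unstopped h) (stop A (h ▷ r)))

  Σ▷-conservation : ∀ {n} (h : RR n) → Σ▷ (λ h′ → unstopped h′ + stopMass h′) h ≡ ℕ→ℚ (suc n) * unstopped h
  Σ▷-conservation {n} h = ΣL-tabulate-const (λ r → r) _ (unstopped h) (unstopped-conservation h)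

  Σ▷-bestStopMass : ∀ {n} (h : RR n) → Σ▷ bestStopMass h ≡ unstopped h * stop A (h ▷ zero)
  Σ▷-bestStopMass {n} h = begin
    stopMass (h ▷ zero) + ΣL (tabulate Fin.suc) (λ r → bestStopMass (h ▷ r))
      ≡⟨ cong (stopMass (h ▷ zero) +_) (ΣL-tabulate-const (Fin.suc {n}) (λ r → bestStopMass (h ▷ r)) 0ℚ (λ _ → refl)) ⟩
    stopMass (h ▷ zero) + ℕ→ℚ n * 0ℚ  ≡⟨ cong (stopMass (h ▷ zero) +_) (*-zeroʳ (ℕ→ℚ n)) ⟩
    stopMass (h ▷ zero) + 0ℚ          ≡⟨ +-identityʳ _ ⟩
    unstopped h * stop A (h ▷ zero)   ∎
    where open ≡-Reasoning

  Σ▷-won : ∀ {n} (h : RR n) → Σ▷ won h ≡ unstopped h * stop A (h ▷ zero) + ℕ→ℚ n * won h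
  Σ▷-won {n} h =
    cong (stopMass (h ▷ zero) +_) (ΣL-tabulate-const (Fin.suc {n}) (λ r → won (h ▷ r)) (won h) (λ _ → refl))

  survival : ℕ → ℚ
  survival n = 𝔼 n unstopped

  -- The LP variable p_i (p_0 is unused).
  bestStopProb : ℕ → ℚ
  bestStopProb zero    = 0ℚ
  bestStopProb (suc n) = 𝔼 (suc n) bestStopMass

  survival-suc : ∀ n → survival (suc n) + 𝔼 (suc n) stopMass ≡ survival n
  survival-suc n = ℕ→ℚ-*-cancelˡ n (begin
    ℕ→ℚ (suc n) * (survival (suc n) + 𝔼 (suc n) stopMass)
      ≡⟨ cong (ℕ→ℚ (suc n) *_) (𝔼-+ (suc n) unstopped stopMass) ⟨
    ℕ→ℚ (suc n) * 𝔼 (suc n) (λ h → unstopped h + stopMass h)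
      ≡⟨ 𝔼-suc n _ ⟩
    𝔼 n (Σ▷ (λ h → unstopped h + stopMass h))
      ≡⟨ 𝔼-cong n Σ▷-conservation ⟩
    𝔼 n (λ h → ℕ→ℚ (suc n) * unstopped h)
      ≡⟨ 𝔼-*ˡ n (ℕ→ℚ (suc n)) unstopped ⟩
    ℕ→ℚ (suc n) * survival n ∎)
    where open ≡-Reasoning

  bestStopProb-suc : ∀ n → ℕ→ℚ (suc n) * bestStopProb (suc n) ≡ 𝔼 n (λ h → unstopped h * stop A (h ▷ zero))
  bestStopProb-suc n = trans (𝔼-suc n bestStopMass) (𝔼-cong n Σ▷-bestStopMass)

  successProb-suc : ∀ n → ℕ→ℚ (suc n) * successProb A (suc n) ≡ ℕ→ℚ n * successProb A n + ℕ→ℚ (suc n) * bestStopProb (suc n)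
  successProb-suc n = begin
    ℕ→ℚ (suc n) * 𝔼 (suc n) won  ≡⟨ 𝔼-suc n won ⟩
    𝔼 n (Σ▷ won)                 ≡⟨ 𝔼-cong n Σ▷-won ⟩
    𝔼 n (λ h → unstopped h * stop A (h ▷ zero) + ℕ→ℚ n * won h)
                                 ≡⟨ 𝔼-+ n _ _ ⟩
    𝔼 n (λ h → unstopped h * stop A (h ▷ zero)) + 𝔼 n (λ h → ℕ→ℚ n * won h)
                                 ≡⟨ cong₂ _+_ (bestStopProb-suc n) (sym (𝔼-*ˡ n (ℕ→ℚ n) won)) ⟨
    ℕ→ℚ (suc n) * bestStopProb (suc n) + ℕ→ℚ n * successProb A n
                                 ≡⟨ +-comm (ℕ→ℚ (suc n) * bestStopProb (suc n)) (ℕ→ℚ n * successProb A n) ⟩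
    ℕ→ℚ n * successProb A n + ℕ→ℚ (suc n) * bestStopProb (suc n) ∎
    where open ≡-Reasoning

  n*successProb≡Σ : ∀ n → ℕ→ℚ n * successProb A n ≡ Σ₁ n (λ i → ℕ→ℚ i * bestStopProb i)
  n*successProb≡Σ zero    = *-zeroˡ (successProb A zero)
  n*successProb≡Σ (suc n) = trans (successProb-suc n) (cong (_+ ℕ→ℚ (suc n) * bestStopProb (suc n)) (n*successProb≡Σ n))

  successProb≡objective : ∀ n → successProb A (suc n) ≡ (1ℤ / suc n) * Σ₁ (suc n) (λ i → ℕ→ℚ i * bestStopProb i)
  successProb≡objective n = trans (sym (1/n*[n*p]≡p (suc n) (successProb A (suc n)))) (cong ((1ℤ / suc n) *_) (n*successProb≡Σ (suc n)))

  0≤bestStopProb : ∀ i → 0ℚ ℚ.≤ bestStopProb i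
  0≤bestStopProb zero    = ≤-refl
  0≤bestStopProb (suc n) = 0≤𝔼 (suc n) 0≤bestStopMass
    where
    0≤bestStopMass : ∀ {i} (h : RR (suc i)) → 0ℚ ℚ.≤ bestStopMass h
    0≤bestStopMass (h ▷ zero)  = 0≤stopMass (h ▷ zero)
    0≤bestStopMass (h ▷ suc r) = ≤-refl

  [1+n]*bestStopProb≤survival : ∀ n → ℕ→ℚ (suc n) * bestStopProb (suc n) ℚ.≤ survival n
  [1+n]*bestStopProb≤survival n = ≤-trans (≤-reflexive (bestStopProb-suc n))
    (𝔼-mono-≤ n (λ h → p*q≤p (0≤unstopped h) (stop≤1 A (h ▷ zero))))

  survival+Σ≤1 : ∀ n → survival n + Σ₁ n bestStopProb ℚ.≤ 1ℚ
  survival+Σ≤1 zero    = ≤-refl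
  survival+Σ≤1 (suc n) = begin
    survival (suc n) + (Σ₁ n bestStopProb + bestStopProb (suc n))
      ≡⟨ solve 3 (λ s Σ x → s :+ (Σ :+ x) := (s :+ x) :+ Σ) refl (survival (suc n)) (Σ₁ n bestStopProb) (bestStopProb (suc n)) ⟩
    (survival (suc n) + bestStopProb (suc n)) + Σ₁ n bestStopProb
      ≤⟨ +-monoˡ-≤ (Σ₁ n bestStopProb) (+-monoʳ-≤ (survival (suc n)) (𝔼-mono-≤ (suc n) bestStopMass≤stopMass)) ⟩
    (survival (suc n) + 𝔼 (suc n) stopMass) + Σ₁ n bestStopProb
      ≡⟨ cong (_+ Σ₁ n bestStopProb) (survival-suc n) ⟩
    survival n + Σ₁ n bestStopProb
      ≤⟨ survival+Σ≤1 n ⟩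
    1ℚ ∎
    where open ≤-Reasoning

algorithm⇒LPFeasible : ∀ {N α} (A : Algorithm) → (∀ n → 1 ≤ n → n ≤ N → α ℚ.≤ successProb A n) →
                       LPFeasible N α (Run.bestStopProb A)
algorithm⇒LPFeasible {N} {α} A guarantee = objective , budget , λ i _ _ → 0≤bestStopProb i
  where
  open Run A
  objective : ∀ n (1≤n : 1 ≤ n) → n ≤ N →
              α ℚ.≤ (1ℤ / n) {{ℕ.>-nonZero 1≤n}} * Σ₁ n (λ i → ℕ→ℚ i * bestStopProb i)
  objective (suc n) 1≤n n≤N = ≤-trans (guarantee (suc n) 1≤n n≤N) (≤-reflexive (successProb≡objective n))
  budget : ∀ i → 1 ≤ i → i ≤ N → Σ₁ (i ℕ.∸ 1) bestStopProb + ℕ→ℚ i * bestStopProb i ℚ.≤ 1ℚ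
  budget (suc k) _ _ = begin
    Σ₁ k bestStopProb + ℕ→ℚ (suc k) * bestStopProb (suc k)  ≤⟨ +-monoʳ-≤ (Σ₁ k bestStopProb) ([1+n]*bestStopProb≤survival k) ⟩
    Σ₁ k bestStopProb + survival k                          ≡⟨ +-comm (Σ₁ k bestStopProb) (survival k) ⟩
    survival k + Σ₁ k bestStopProb                          ≤⟨ survival+Σ≤1 k ⟩
    1ℚ                                                      ∎
    where open ≤-Reasoning

module LPAlgorithm (N : ℕ) (p : ℕ → ℚ)
  (budget : ∀ i → 1 ≤ i → i ≤ N → Σ₁ (i ℕ.∸ 1) p + ℕ→ℚ i * p i ℚ.≤ 1ℚ)
  (0≤p : ∀ i → 1 ≤ i → i ≤ N → 0ℚ ℚ.≤ p i) where

  remaining : ℕ → ℚ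
  remaining k = 1ℚ - Σ₁ k p

  [1+k]*p≤remaining : ∀ k → suc k ≤ N → ℕ→ℚ (suc k) * p (suc k) ℚ.≤ remaining k
  [1+k]*p≤remaining k k<N = begin
    ℕ→ℚ (suc k) * p (suc k)                      ≡⟨ solve 2 (λ s a → a := (s :+ a) :- s) refl (Σ₁ k p) _ ⟩
    (Σ₁ k p + ℕ→ℚ (suc k) * p (suc k)) - Σ₁ k p  ≤⟨ +-monoˡ-≤ (- Σ₁ k p) (budget (suc k) (s≤s z≤n) k<N) ⟩
    remaining k                                  ∎
    where open ≤-Reasoning

  0≤[1+k]*p : ∀ k → suc k ≤ N → 0ℚ ℚ.≤ ℕ→ℚ (suc k) * p (suc k)
  0≤[1+k]*p k k<N = 0≤p*q (0≤ℕ→ℚ (suc k)) (0≤p (suc k) (s≤s z≤n) k<N)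

  stopRatio : ∀ k → ∃ λ q → (0ℚ ℚ.≤ q × q ℚ.≤ 1ℚ) × (suc k ≤ N → remaining k * q ≡ ℕ→ℚ (suc k) * p (suc k))
  -- Beyond N the LP says nothing about p, so there the algorithm never stops.
  stopRatio k with suc k ℕ.≤? N
  ... | yes k<N = let (q , q∈[0,1] , rq≡a) = ratio∈[0,1] (0≤[1+k]*p k k<N) ([1+k]*p≤remaining k k<N)
                  in q , q∈[0,1] , λ _ → rq≡a
  ... | no  k≮N = 0ℚ , (≤-refl , ≤ᵇ⇒≤ _) , λ k<N → ⊥-elim (k≮N k<N)

  stopAt : ∀ {i} → RR (suc i) → ℚ
  stopAt {i} (h ▷ zero)  = proj₁ (stopRatio i)
  stopAt     (h ▷ suc r) = 0ℚ

  algorithm : Algorithm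
  algorithm = record { stop = stopAt ; stop≥0 = 0≤stopAt ; stop≤1 = stopAt≤1 }
    where
    0≤stopAt : ∀ {i} (h : RR (suc i)) → 0ℚ ℚ.≤ stopAt h
    0≤stopAt {i} (h ▷ zero)  = proj₁ (proj₁ (proj₂ (stopRatio i)))
    0≤stopAt     (h ▷ suc r) = ≤-refl
    stopAt≤1 : ∀ {i} (h : RR (suc i)) → stopAt h ℚ.≤ 1ℚ
    stopAt≤1 {i} (h ▷ zero)  = proj₂ (proj₁ (proj₂ (stopRatio i)))
    stopAt≤1     (h ▷ suc r) = ≤ᵇ⇒≤ _

  open Run algorithm

  survival-suc-onlyBest : ∀ n → survival (suc n) + bestStopProb (suc n) ≡ survival n
  survival-suc-onlyBest n = trans (cong (survival (suc n) +_) (𝔼-cong (suc n) bestStopMass≡stopMass)) (survival-suc n)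
    where
    bestStopMass≡stopMass : ∀ {i} (h : RR (suc i)) → bestStopMass h ≡ stopMass h
    bestStopMass≡stopMass (h ▷ zero)  = refl
    bestStopMass≡stopMass (h ▷ suc r) = sym (*-zeroʳ (unstopped h))

  bestStopProb≡p : ∀ k → suc k ≤ N → survival k ≡ remaining k → bestStopProb (suc k) ≡ p (suc k)
  bestStopProb≡p k k<N survival≡remaining = ℕ→ℚ-*-cancelˡ k (begin
    ℕ→ℚ (suc k) * bestStopProb (suc k)  ≡⟨ bestStopProb-suc k ⟩
    𝔼 k (λ h → unstopped h * q)         ≡⟨ 𝔼-cong k (λ h → *-comm (unstopped h) q) ⟩
    𝔼 k (λ h → q * unstopped h)         ≡⟨ 𝔼-*ˡ k q unstopped ⟩
    q * survival k                      ≡⟨ *-comm q (survival k) ⟩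
    survival k * q                      ≡⟨ cong (_* q) survival≡remaining ⟩
    remaining k * q                     ≡⟨ proj₂ (proj₂ (stopRatio k)) k<N ⟩
    ℕ→ℚ (suc k) * p (suc k)             ∎)
    where
    open ≡-Reasoning
    q = proj₁ (stopRatio k)

  survival≡remaining : ∀ k → k ≤ N → survival k ≡ remaining k
  survival≡remaining zero    _   = refl
  survival≡remaining (suc k) k<N = begin
    survival (suc k)
      ≡⟨ solve 2 (λ s x → s := (s :+ x) :- x) refl (survival (suc k)) (bestStopProb (suc k)) ⟩
    (survival (suc k) + bestStopProb (suc k)) - bestStopProb (suc k)
      ≡⟨ cong₂ _-_ (survival-suc-onlyBest k) x≡p ⟩
    survival k - p (suc k)
      ≡⟨ cong (_- p (suc k)) IH ⟩
    remaining k - p (suc k)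
      ≡⟨ solve 2 (λ s x → con 1ℚ :- s :- x := con 1ℚ :- (s :+ x)) refl (Σ₁ k p) (p (suc k)) ⟩
    remaining (suc k) ∎
    where
    open ≡-Reasoning
    IH = survival≡remaining k (ℕ.<⇒≤ k<N)
    x≡p = bestStopProb≡p k k<N IH

  objectiveSum-agrees : ∀ n → n ≤ N → Σ₁ n (λ i → ℕ→ℚ i * bestStopProb i) ≡ Σ₁ n (λ i → ℕ→ℚ i * p i)
  objectiveSum-agrees zero    _   = refl
  objectiveSum-agrees (suc n) n<N = cong₂ _+_ (objectiveSum-agrees n (ℕ.<⇒≤ n<N))
    (cong (ℕ→ℚ (suc n) *_) (bestStopProb≡p n n<N (survival≡remaining n (ℕ.<⇒≤ n<N))))

  guarantee : ∀ {α} →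
              (∀ n (1≤n : 1 ≤ n) → n ≤ N → α ℚ.≤ (1ℤ / n) {{ℕ.>-nonZero 1≤n}} * Σ₁ n (λ i → ℕ→ℚ i * p i)) →
              ∀ n → 1 ≤ n → n ≤ N → α ℚ.≤ successProb algorithm n
  guarantee objective (suc n) 1≤n n≤N = ≤-trans (objective (suc n) 1≤n n≤N)
    (≤-reflexive (sym (trans (successProb≡objective n) (cong ((1ℤ / suc n) *_) (objectiveSum-agrees (suc n) n≤N)))))

lemma2 : ∀ (N : ℕ) → 1 ≤ N → ∀ (α : ℚ) → Achievable N α ⇔ (∃ λ p → LPFeasible N α p)
lemma2 N _ α = mk⇔
  (λ (A , guarantee) → Run.bestStopProb A , algorithm⇒LPFeasible A guarantee)
  (λ (p , objective , budget , 0≤p) → LPAlgorithm.algorithm N p budget 0≤p , LPAlgorithm.guarantee N p budget 0≤p objective)
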